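{- Let $G_1=(V,E_1)$ and $G_2=(V,E_2)$ be graphs on a common vertex set, each of maximum degree at most $\Delta$. Let $\widehat G$ be the graph with vertex set $E_1\cup E_2$ in which two distinct edges $e,e'$ are adjacent iff they share an endpoint and either both lie in $E_1$ or both lie in $E_2$. For $w\in E_1\cup E_2$ define $W(w)=2$ if $w\in E_1\cap E_2$ and $W(w)=1$ otherwise. Then for every vertex $v$ of $\widehat G$, $$\sum_{w\in N_{\widehat G}(v)} W(w)\le 4\Delta.$$
   Context: $N_{\widehat G}(v)$ denotes the set of neighbors of $v$ in $\widehat G$. -}

module Defs where

open import Data.Nat using (ℕ; _+_; _*_; _≤_; _<_)
open import Data.Nat.Properties using (_<?_)
open import Data.Bool using (Bool; true; false; if_then_else_; _∧_; _∨_; not; T)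
open import Data.Fin using (Fin; toℕ; _≟_)
open import Data.List using (List; map; allFin)
open import Data.Nat.ListAction using (sum)
open import Relation.Nullary.Decidable using (⌊_⌋)
open import Relation.Binary.PropositionalEquality using (_≡_)

record Graph (n : ℕ) : Set where
  field
    adj    : Fin n → Fin n → Bool
    sym    : ∀ i j → adj i j ≡ adj j i
    irrefl : ∀ i → adj i i ≡ false
open Graph public

ind : Bool → ℕ
ind b = if b then 1 else 0

Σ[_]_ : (n : ℕ) → (Fin n → ℕ) → ℕ
Σ[ n ] f = sum (map f (allFin n))

degree : ∀ {n} → Graph n → Fin n → ℕ
degree {n} G v = Σ[ n ] (λ u → ind (adj G v u))

MaxDegreeAtMost : ∀ {n} → Graph n → ℕ → Set
MaxDegreeAtMost {n} G Δ = ∀ v → degree G v ≤ Δ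

-- An (unordered) edge {i,j} is represented canonically by the ordered
-- pair (i , j) with toℕ i < toℕ j.
lt : ∀ {n} → Fin n → Fin n → Bool
lt i j = ⌊ toℕ i <? toℕ j ⌋

inE : ∀ {n} → Graph n → Fin n → Fin n → Bool
inE G i j = lt i j ∧ adj G i j

inUnion : ∀ {n} → Graph n → Graph n → Fin n → Fin n → Bool
inUnion G₁ G₂ i j = inE G₁ i j ∨ inE G₂ i j

record HatVertex {n : ℕ} (G₁ G₂ : Graph n) : Set where
  constructor hv
  field
    a b   : Fin n
    inU   : T (inUnion G₁ G₂ a b)
open HatVertex public

eqF : ∀ {n} → Fin n → Fin n → Bool
eqF i j = ⌊ i ≟ j ⌋

hatAdj : ∀ {n} → Graph n → Graph n → Fin n → Fin n → Fin n → Fin n → Bool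
hatAdj G₁ G₂ a b i j =
  not (eqF a i ∧ eqF b j)
  ∧ (eqF a i ∨ eqF a j ∨ eqF b i ∨ eqF b j)
  ∧ ((inE G₁ a b ∧ inE G₁ i j) ∨ (inE G₂ a b ∧ inE G₂ i j))

W : ∀ {n} → Graph n → Graph n → Fin n → Fin n → ℕ
W G₁ G₂ i j = if inE G₁ i j ∧ inE G₂ i j then 2 else 1

neighbourWeight : ∀ {n} (G₁ G₂ : Graph n) → HatVertex G₁ G₂ → ℕ
neighbourWeight {n} G₁ G₂ v =
  Σ[ n ] λ i → Σ[ n ] λ j →
    ind (hatAdj G₁ G₂ (a v) (b v) i j) * W G₁ G₂ i j

-- A neighbour w of v = {a, b} in Ĝ contains a or b and lies in E₁ or E₂.
-- Its weight W(w) equals [w ∈ E₁] + [w ∈ E₂], and its adjacency to v is at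
-- most the number of endpoints of w among a and b.  Summing, the total is at
-- most the number of edges of G₁ or G₂ at a or b, counted once for each of
-- these four (graph, endpoint) choices, hence at most 4Δ.
module Submission where

open import Defs hiding (sym)
open import Data.Nat using (ℕ; zero; suc; _+_; _*_; _≤_; z≤n; s≤s)
open import Data.Nat.Properties hiding (_≟_)
open import Data.Bool using (Bool; true; false; _∧_; _∨_; not; if_then_else_)
open import Data.Bool.Properties using (∧-zeroʳ)
open import Data.Fin using (Fin; zero; suc; toℕ; _≟_)
open import Data.List using (map; tabulate)
open import Data.List.Properties using (map-tabulate)
open import Data.Nat.ListAction using (sum)
open import Data.Empty using (⊥-elim)
open import Relation.Nullary using (yes; no)
open import Relation.Binary.PropositionalEquality
  using (_≡_; refl; sym; trans; cong; cong₂; module ≡-Reasoning)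
open import Algebra.Properties.Semiring.Sum +-*-semiring
  using (sum-syntax; sum-cong-≗; ∑-distrib-+; *-distribˡ-sum; sum-replicate-zero)

Σ≡∑ : ∀ n (f : Fin n → ℕ) → Σ[ n ] f ≡ ∑[ i < n ] f i
Σ≡∑ zero    f = refl
Σ≡∑ (suc n) f = cong (f zero +_) (begin
  sum (map f (tabulate suc))        ≡⟨ cong sum (map-tabulate suc f) ⟩
  sum (tabulate (λ i → f (suc i)))  ≡⟨ cong sum (map-tabulate (λ i → i) (λ i → f (suc i))) ⟨
  Σ[ n ] (λ i → f (suc i))          ≡⟨ Σ≡∑ n (λ i → f (suc i)) ⟩
  ∑[ i < n ] f (suc i)              ∎)
  where open ≡-Reasoning

ΣΣ≡∑∑ : ∀ m n (f : Fin m → Fin n → ℕ) →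
        Σ[ m ] (λ i → Σ[ n ] f i) ≡ ∑[ i < m ] ∑[ j < n ] f i j
ΣΣ≡∑∑ m n f = trans (Σ≡∑ m _) (sum-cong-≗ (λ i → Σ≡∑ n (f i)))

∑-mono-≤ : ∀ {n} {f g : Fin n → ℕ} → (∀ i → f i ≤ g i) → ∑[ i < n ] f i ≤ ∑[ i < n ] g i
∑-mono-≤ {zero}  f≤g = z≤n
∑-mono-≤ {suc n} f≤g = +-mono-≤ (f≤g zero) (∑-mono-≤ (λ i → f≤g (suc i)))

∑∑-distrib-+ : ∀ {m n} (f g : Fin m → Fin n → ℕ) →
               ∑[ i < m ] ∑[ j < n ] (f i j + g i j) ≡
               ∑[ i < m ] ∑[ j < n ] f i j + ∑[ i < m ] ∑[ j < n ] g i j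
∑∑-distrib-+ {m} {n} f g = trans (sum-cong-≗ (λ i → ∑-distrib-+ (f i) (g i)))
  (∑-distrib-+ (λ i → ∑[ j < n ] f i j) (λ i → ∑[ j < n ] g i j))

eqF-suc : ∀ {n} (a i : Fin n) → eqF (suc a) (suc i) ≡ eqF a i
eqF-suc a i with a ≟ i
... | yes _ = refl
... | no  _ = refl

∑-δ : ∀ {n} (a : Fin n) (g : Fin n → ℕ) → ∑[ i < n ] (ind (eqF a i) * g i) ≡ g a
∑-δ {suc n} zero g = begin
  1 * g zero + ∑[ i < n ] 0  ≡⟨ cong₂ _+_ (*-identityˡ (g zero)) (sum-replicate-zero n) ⟩
  g zero + 0                 ≡⟨ +-identityʳ (g zero) ⟩
  g zero                     ∎
  where open ≡-Reasoning
∑-δ {suc n} (suc a) g = begin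
  ∑[ i < n ] (ind (eqF (suc a) (suc i)) * g (suc i))
    ≡⟨ sum-cong-≗ (λ i → cong (λ e → ind e * g (suc i)) (eqF-suc a i)) ⟩
  ∑[ i < n ] (ind (eqF a i) * g (suc i))
    ≡⟨ ∑-δ a (λ i → g (suc i)) ⟩
  g (suc a) ∎
  where open ≡-Reasoning

ind-∧ : ∀ p q → ind (p ∧ q) ≡ ind p * ind q
ind-∧ false q = refl
ind-∧ true  q = sym (*-identityˡ (ind q))

ind-∧-≤ʳ : ∀ p q → ind (p ∧ q) ≤ ind q
ind-∧-≤ʳ false q = z≤n
ind-∧-≤ʳ true  q = ≤-refl

ind-∨-≤ : ∀ p q → ind (p ∨ q) ≤ ind p + ind q
ind-∨-≤ false q = ≤-refl
ind-∨-≤ true  q = s≤s z≤n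

ind-∨₄-≤ : ∀ p q r s → ind (p ∨ q ∨ r ∨ s) ≤ (ind p + ind q) + (ind r + ind s)
ind-∨₄-≤ p q r s = begin
  ind (p ∨ q ∨ r ∨ s)                  ≤⟨ ind-∨-≤ p _ ⟩
  ind p + ind (q ∨ r ∨ s)              ≤⟨ +-monoʳ-≤ (ind p) (ind-∨-≤ q _) ⟩
  ind p + (ind q + ind (r ∨ s))        ≤⟨ +-monoʳ-≤ (ind p) (+-monoʳ-≤ (ind q) (ind-∨-≤ r s)) ⟩
  ind p + (ind q + (ind r + ind s))    ≡⟨ +-assoc (ind p) (ind q) _ ⟨
  (ind p + ind q) + (ind r + ind s)    ∎
  where open ≤-Reasoning

ind-≤-1 : ∀ p → ind p ≤ 1
ind-≤-1 false = z≤n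
ind-≤-1 true  = ≤-refl

ind-∨-∧-≤ : ∀ d e x y → ind ((d ∧ x) ∨ (e ∧ y)) ≤ ind (x ∨ y)
ind-∨-∧-≤ d e true  y = ind-≤-1 ((d ∧ true) ∨ (e ∧ y))
ind-∨-∧-≤ d e false y rewrite ∧-zeroʳ d = ind-∧-≤ʳ e y

ind-∨-*-weight : ∀ x y → ind (x ∨ y) * (if x ∧ y then 2 else 1) ≡ ind x + ind y
ind-∨-*-weight false false = refl
ind-∨-*-weight false true  = refl
ind-∨-*-weight true  false = refl
ind-∨-*-weight true  true  = refl

incidence : ∀ {n} → Fin n → Fin n → Fin n → ℕ
incidence u i j = ind (eqF u i) + ind (eqF u j)

inE-both-ways-≤-adj : ∀ {n} (G : Graph n) (u k : Fin n) →
                      ind (inE G u k) + ind (inE G k u) ≤ ind (adj G u k)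
inE-both-ways-≤-adj G u k
  rewrite Graph.sym G k u with toℕ u <? toℕ k | toℕ k <? toℕ u
... | yes u<k | yes k<u = ⊥-elim (<-asym u<k k<u)
... | yes _   | no  _   = ≤-reflexive (+-identityʳ _)
... | no  _   | yes _   = ≤-refl
... | no  _   | no  _   = z≤n

∑-incident-edges-≤-degree : ∀ {n} (G : Graph n) (u : Fin n) →
  ∑[ i < n ] ∑[ j < n ] (incidence u i j * ind (inE G i j)) ≤ degree G u
∑-incident-edges-≤-degree {n} G u = begin
  ∑[ i < n ] ∑[ j < n ] (incidence u i j * e i j)
    ≡⟨ sum-cong-≗ (λ i → sum-cong-≗ (λ j → *-distribʳ-+ (e i j) (ind (eqF u i)) (ind (eqF u j)))) ⟩
  ∑[ i < n ] ∑[ j < n ] (ind (eqF u i) * e i j + ind (eqF u j) * e i j)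
    ≡⟨ ∑∑-distrib-+ (λ i j → ind (eqF u i) * e i j) (λ i j → ind (eqF u j) * e i j) ⟩
  ∑[ i < n ] ∑[ j < n ] (ind (eqF u i) * e i j) + ∑[ i < n ] ∑[ j < n ] (ind (eqF u j) * e i j)
    ≡⟨ cong₂ _+_ edges-from-u edges-into-u ⟩
  ∑[ k < n ] e u k + ∑[ k < n ] e k u
    ≡⟨ ∑-distrib-+ (λ k → e u k) (λ k → e k u) ⟨
  ∑[ k < n ] (e u k + e k u)
    ≤⟨ ∑-mono-≤ (inE-both-ways-≤-adj G u) ⟩
  ∑[ k < n ] ind (adj G u k)
    ≡⟨ Σ≡∑ n (λ k → ind (adj G u k)) ⟨
  degree G u ∎
  where
  open ≤-Reasoning
  e : Fin n → Fin n → ℕ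
  e i j = ind (inE G i j)
  edges-from-u : ∑[ i < n ] ∑[ j < n ] (ind (eqF u i) * e i j) ≡ ∑[ k < n ] e u k
  edges-from-u = trans (sum-cong-≗ (λ i → sym (*-distribˡ-sum (ind (eqF u i)) (e i))))
                       (∑-δ u (λ i → ∑[ j < n ] e i j))
  edges-into-u : ∑[ i < n ] ∑[ j < n ] (ind (eqF u j) * e i j) ≡ ∑[ k < n ] e k u
  edges-into-u = sum-cong-≗ (λ i → ∑-δ u (e i))

∑-endpoint-edges-≤ : ∀ {n Δ} (G : Graph n) → MaxDegreeAtMost G Δ → (a b : Fin n) →
  ∑[ i < n ] ∑[ j < n ] ((incidence a i j + incidence b i j) * ind (inE G i j)) ≤ 2 * Δ
∑-endpoint-edges-≤ {n} {Δ} G degree≤Δ a b = begin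
  ∑[ i < n ] ∑[ j < n ] ((incidence a i j + incidence b i j) * e i j)
    ≡⟨ sum-cong-≗ (λ i → sum-cong-≗ (λ j → *-distribʳ-+ (e i j) (incidence a i j) (incidence b i j))) ⟩
  ∑[ i < n ] ∑[ j < n ] (incidence a i j * e i j + incidence b i j * e i j)
    ≡⟨ ∑∑-distrib-+ (λ i j → incidence a i j * e i j) (λ i j → incidence b i j * e i j) ⟩
  ∑[ i < n ] ∑[ j < n ] (incidence a i j * e i j) + ∑[ i < n ] ∑[ j < n ] (incidence b i j * e i j)
    ≤⟨ +-mono-≤ (≤-trans (∑-incident-edges-≤-degree G a) (degree≤Δ a))
                (≤-trans (∑-incident-edges-≤-degree G b) (degree≤Δ b)) ⟩
  Δ + Δ
    ≡⟨ cong (Δ +_) (+-identityʳ Δ) ⟨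
  2 * Δ ∎
  where
  open ≤-Reasoning
  e : Fin n → Fin n → ℕ
  e i j = ind (inE G i j)

hatAdj-weight-≤ : ∀ {n} (G₁ G₂ : Graph n) (a b i j : Fin n) →
  ind (hatAdj G₁ G₂ a b i j) * W G₁ G₂ i j ≤
  (incidence a i j + incidence b i j) * (ind (inE G₁ i j) + ind (inE G₂ i j))
hatAdj-weight-≤ G₁ G₂ a b i j = begin
  ind (not (eqF a i ∧ eqF b j) ∧ shared ∧ sameGraph) * w
    ≤⟨ *-monoˡ-≤ w (ind-∧-≤ʳ (not (eqF a i ∧ eqF b j)) (shared ∧ sameGraph)) ⟩
  ind (shared ∧ sameGraph) * w
    ≡⟨ cong (_* w) (ind-∧ shared sameGraph) ⟩
  ind shared * ind sameGraph * w
    ≡⟨ *-assoc (ind shared) (ind sameGraph) w ⟩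
  ind shared * (ind sameGraph * w)
    ≤⟨ *-mono-≤ (ind-∨₄-≤ (eqF a i) (eqF a j) (eqF b i) (eqF b j)) sameGraph-weight-≤ ⟩
  (incidence a i j + incidence b i j) * (ind x + ind y) ∎
  where
  open ≤-Reasoning
  x y shared sameGraph : Bool
  x = inE G₁ i j
  y = inE G₂ i j
  shared = eqF a i ∨ eqF a j ∨ eqF b i ∨ eqF b j
  sameGraph = (inE G₁ a b ∧ x) ∨ (inE G₂ a b ∧ y)
  w : ℕ
  w = W G₁ G₂ i j
  sameGraph-weight-≤ : ind sameGraph * w ≤ ind x + ind y
  sameGraph-weight-≤ = ≤-trans (*-monoˡ-≤ w (ind-∨-∧-≤ (inE G₁ a b) (inE G₂ a b) x y))
                               (≤-reflexive (ind-∨-*-weight x y))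

proposition3p1 : (n Δ : ℕ) (G₁ G₂ : Graph n) →
    MaxDegreeAtMost G₁ Δ → MaxDegreeAtMost G₂ Δ →
    (v : HatVertex G₁ G₂) → neighbourWeight G₁ G₂ v ≤ 4 * Δ
proposition3p1 n Δ G₁ G₂ degree₁≤Δ degree₂≤Δ v@(hv a b _) = begin
  neighbourWeight G₁ G₂ v
    ≡⟨ ΣΣ≡∑∑ n n (λ i j → ind (hatAdj G₁ G₂ a b i j) * W G₁ G₂ i j) ⟩
  ∑[ i < n ] ∑[ j < n ] (ind (hatAdj G₁ G₂ a b i j) * W G₁ G₂ i j)
    ≤⟨ ∑-mono-≤ (λ i → ∑-mono-≤ (hatAdj-weight-≤ G₁ G₂ a b i)) ⟩
  ∑[ i < n ] ∑[ j < n ] (I i j * (e₁ i j + e₂ i j))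
    ≡⟨ sum-cong-≗ (λ i → sum-cong-≗ (λ j → *-distribˡ-+ (I i j) (e₁ i j) (e₂ i j))) ⟩
  ∑[ i < n ] ∑[ j < n ] (I i j * e₁ i j + I i j * e₂ i j)
    ≡⟨ ∑∑-distrib-+ (λ i j → I i j * e₁ i j) (λ i j → I i j * e₂ i j) ⟩
  ∑[ i < n ] ∑[ j < n ] (I i j * e₁ i j) + ∑[ i < n ] ∑[ j < n ] (I i j * e₂ i j)
    ≤⟨ +-mono-≤ (∑-endpoint-edges-≤ G₁ degree₁≤Δ a b) (∑-endpoint-edges-≤ G₂ degree₂≤Δ a b) ⟩
  2 * Δ + 2 * Δ
    ≡⟨ *-distribʳ-+ Δ 2 2 ⟨
  4 * Δ ∎
  where
  open ≤-Reasoning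
  I e₁ e₂ : Fin n → Fin n → ℕ
  I i j = incidence a i j + incidence b i j
  e₁ i j = ind (inE G₁ i j)
  e₂ i j = ind (inE G₂ i j)
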